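{- $$\lim_{n\to \infty} \frac{\overline{{\rm deg}}(\Gamma_n)}{n} = \lim_{n\to \infty} \frac{\overline{{\rm deg}}(\Lambda_n)}{n} = \frac{5-\sqrt{5}}{5}\,.$$
   Context: $Q_n$ has vertex set the binary strings of length $n$, two being adjacent iff they differ in exactly one position. A Fibonacci string is a binary string $b_1\ldots b_n$ with $b_ib_{i+1}=0$ for $1\le i<n$; a Lucas string additionally satisfies $b_1b_n=0$. The Fibonacci cube $\Gamma_n$ and Lucas cube $\Lambda_n$ are the subgraphs of $Q_n$ induced by the Fibonacci strings, respectively the Lucas strings, of length $n$. For a graph $G$, $\overline{{\rm deg}}(G)=\frac{1}{|V(G)|}\sum_{u\in V(G)}\deg(u)$ is the average degree. -}

module Defs where

open import Data.Bool using (Bool; true; false; not; _∧_; if_then_else_)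
open import Data.Nat using (ℕ; zero; suc; _∸_; _≥_; _≡ᵇ_)
open import Data.Nat.ListAction using (sum)
open import Data.List using (List; []; _∷_; filter; length; map; concatMap)
open import Data.Vec using (Vec; []; _∷_; last)
open import Data.Integer using (+_)
open import Data.Rational.Unnormalised using (ℚᵘ; mkℚᵘ; _<_; _≤_; _-_; _+_; _*_; 0ℚᵘ; 1ℚᵘ)
open import Data.Product using (_×_; ∃)
open import Data.Sum using (_⊎_)
open import Relation.Binary.PropositionalEquality using (_≡_)

allStrings : (n : ℕ) → List (Vec Bool n)
allStrings zero    = [] ∷ []
allStrings (suc n) = concatMap (λ v → (false ∷ v) ∷ (true ∷ v) ∷ []) (allStrings n)

hamming : {n : ℕ} → Vec Bool n → Vec Bool n → ℕ
hamming []       []       = 0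
hamming (x ∷ xs) (y ∷ ys) = (if x Data.Bool.xor y then 1 else 0) Data.Nat.+ hamming xs ys

isFib : {n : ℕ} → Vec Bool n → Bool
isFib []               = true
isFib (x ∷ [])         = true
isFib (x ∷ y ∷ r)      = not (x ∧ y) ∧ isFib (y ∷ r)

isLucas : {n : ℕ} → Vec Bool n → Bool
isLucas []       = true
isLucas (x ∷ xs) = isFib (x ∷ xs) ∧ not (x ∧ last (x ∷ xs))

bfilter : {A : Set} → (A → Bool) → List A → List A
bfilter p []       = []
bfilter p (x ∷ xs) = if p x then x ∷ bfilter p xs else bfilter p xs

vertices : (n : ℕ) → (Vec Bool n → Bool) → List (Vec Bool n)
vertices n P = bfilter P (allStrings n)

degree : (n : ℕ) → (Vec Bool n → Bool) → Vec Bool n → ℕ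
degree n P u = length (bfilter (λ v → hamming u v ≡ᵇ 1) (vertices n P))

degSum : (n : ℕ) → (Vec Bool n → Bool) → ℕ
degSum n P = sum (map (degree n P) (vertices n P))

-- average degree divided by n:  degSum / (|V| * n).
-- (mkℚᵘ p k denotes p / (k+1); denominator |V|*n ≥ 1 for every n ≥ 1,
--  the n = 0 term is irrelevant for the limit.)
avgDegOverN : (n : ℕ) → (Vec Bool n → Bool) → ℚᵘ
avgDegOverN n P = mkℚᵘ (+ degSum n P) (length (vertices n P) Data.Nat.* n ∸ 1)

Γ-ratio : ℕ → ℚᵘ
Γ-ratio n = avgDegOverN n isFib

Λ-ratio : ℕ → ℚᵘ
Λ-ratio n = avgDegOverN n isLucas

-- The real number L = (5 - √5)/5 = 1 - 1/√5, given by its Dedekind cut on ℚ.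
-- q < L  ⇔  1/√5 < 1 - q  ⇔  0 < 1 - q  and  1/5 < (1 - q)²
-- L < q  ⇔  1 - q < 1/√5  ⇔  1 - q ≤ 0  or  (1 - q)² < 1/5   
oneFifth : ℚᵘ
oneFifth = mkℚᵘ (+ 1) 4

BelowL : ℚᵘ → Set
BelowL q = (0ℚᵘ < 1ℚᵘ - q) × (oneFifth < (1ℚᵘ - q) * (1ℚᵘ - q))

AboveL : ℚᵘ → Set
AboveL q = (1ℚᵘ - q ≤ 0ℚᵘ) ⊎ ((1ℚᵘ - q) * (1ℚᵘ - q) < oneFifth)

-- a_n → (5 - √5)/5 : for every rational ε > 0 there is N such that for all n ≥ N,
-- a_n - ε < L < a_n + ε, i.e. |a_n - L| < ε.
ConvergesToL : (ℕ → ℚᵘ) → Set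
ConvergesToL a = ∀ (ε : ℚᵘ) → 0ℚᵘ < ε →
  ∃ λ (N : ℕ) → ∀ (n : ℕ) → n ≥ N → BelowL (a n - ε) × AboveL (a n + ε)

module Submission where

-- The degree sum of an induced subcube counts ordered pairs of its vertices at Hamming
-- distance 1.  Splitting strings by their first letter (a transfer-matrix recursion) gives the
-- classical closed forms, with F the Fibonacci numbers:
--   |V(Γ_n)| = F_{n+2},           5·degSum(Γ_n) = 2n F_{n+1} + 4(n+1) F_n,
--   |V(Λ_n)| = F_{n+1} + F_{n-1},   degSum(Λ_n) = 2n F_{n-1}.
-- Hence 1 − avgdeg/n = P_n/M_n for explicit P_n, M_n, and Cassini's identity
-- F_{k+1}² − F_{k+1}F_k − F_k² = ±1 shows |5P_n² − M_n²| ≤ K·M_n²/n.  Since L is given by its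
-- Dedekind cut (1 − L)² = 1/5, such a "certificate" for all large n implies convergence.

open import Defs
open import Data.Product using (_×_)

module Sums where

  open import Data.Bool using (Bool; true; false)
  open import Data.Nat using (ℕ; suc; _+_; _*_; _≡ᵇ_)
  open import Data.Nat.Properties using (+-assoc; +-identityʳ; *-zeroʳ; *-distribˡ-+; *-assoc)
  open import Data.Nat.ListAction using (sum)
  open import Data.Nat.Tactic.RingSolver using (solve-∀)
  open import Data.List using (List; []; _∷_; length; map)
  open import Data.Vec using (Vec; _∷_)
  open import Relation.Binary.PropositionalEquality

  𝟙 : Bool → ℕ
  𝟙 true  = 1
  𝟙 false = 0

  ΣL : {A : Set} → (A → ℕ) → List A → ℕ
  ΣL f xs = sum (map f xs)

  ΣL-cong : {A : Set} {f g : A → ℕ} (xs : List A) → (∀ x → f x ≡ g x) → ΣL f xs ≡ ΣL g xs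
  ΣL-cong []       f≗g = refl
  ΣL-cong (x ∷ xs) f≗g = cong₂ _+_ (f≗g x) (ΣL-cong xs f≗g)

  ΣL-+ : {A : Set} (f g : A → ℕ) (xs : List A) → ΣL (λ x → f x + g x) xs ≡ ΣL f xs + ΣL g xs
  ΣL-+ f g []       = refl
  ΣL-+ f g (x ∷ xs) = trans (cong (f x + g x +_) (ΣL-+ f g xs)) (interchange (f x) (g x) _ _)
    where
    interchange : ∀ a b c d → a + b + (c + d) ≡ a + c + (b + d)
    interchange = solve-∀

  ΣL-*ˡ : {A : Set} (c : ℕ) (f : A → ℕ) (xs : List A) → ΣL (λ x → c * f x) xs ≡ c * ΣL f xs
  ΣL-*ˡ c f []       = sym (*-zeroʳ c)
  ΣL-*ˡ c f (x ∷ xs) = trans (cong (c * f x +_) (ΣL-*ˡ c f xs)) (sym (*-distribˡ-+ c (f x) _))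

  ΣL-bfilter : {A : Set} (P : A → Bool) (f : A → ℕ) (xs : List A) →
               ΣL f (bfilter P xs) ≡ ΣL (λ x → 𝟙 (P x) * f x) xs
  ΣL-bfilter P f []       = refl
  ΣL-bfilter P f (x ∷ xs) with P x
  ... | true  = cong₂ _+_ (sym (+-identityʳ (f x))) (ΣL-bfilter P f xs)
  ... | false = ΣL-bfilter P f xs

  length-bfilter : {A : Set} (P : A → Bool) (xs : List A) → length (bfilter P xs) ≡ ΣL (λ x → 𝟙 (P x)) xs
  length-bfilter P []       = refl
  length-bfilter P (x ∷ xs) with P x
  ... | true  = cong suc (length-bfilter P xs)
  ... | false = length-bfilter P xs

  ΣL-allStrings : ∀ n (f : Vec Bool (suc n) → ℕ) →
                  ΣL f (allStrings (suc n)) ≡ ΣL (λ v → f (false ∷ v) + f (true ∷ v)) (allStrings n)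
  ΣL-allStrings n f = go (allStrings n)
    where
    go : (xs : List (Vec Bool n)) →
         ΣL f (Data.List.concatMap (λ v → (false ∷ v) ∷ (true ∷ v) ∷ []) xs) ≡
         ΣL (λ v → f (false ∷ v) + f (true ∷ v)) xs
    go []       = refl
    go (x ∷ xs) = trans (cong (λ s → f (false ∷ x) + (f (true ∷ x) + s)) (go xs))
                        (sym (+-assoc (f (false ∷ x)) (f (true ∷ x)) _))

  Σ2 : ∀ n → (Vec Bool n → Vec Bool n → ℕ) → ℕ
  Σ2 n f = ΣL (λ u → ΣL (f u) (allStrings n)) (allStrings n)

  Σ2-cong : ∀ n {f g : Vec Bool n → Vec Bool n → ℕ} → (∀ u v → f u v ≡ g u v) → Σ2 n f ≡ Σ2 n g
  Σ2-cong n f≗g = ΣL-cong (allStrings n) (λ u → ΣL-cong (allStrings n) (f≗g u))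

  Σ2-+ : ∀ n (f g : Vec Bool n → Vec Bool n → ℕ) → Σ2 n (λ u v → f u v + g u v) ≡ Σ2 n f + Σ2 n g
  Σ2-+ n f g = trans (ΣL-cong (allStrings n) (λ u → ΣL-+ (f u) (g u) (allStrings n))) (ΣL-+ _ _ (allStrings n))

  Σ2-*ˡ : ∀ n (c : ℕ) (f : Vec Bool n → Vec Bool n → ℕ) → Σ2 n (λ u v → c * f u v) ≡ c * Σ2 n f
  Σ2-*ˡ n c f = trans (ΣL-cong (allStrings n) (λ u → ΣL-*ˡ c (f u) (allStrings n))) (ΣL-*ˡ c _ (allStrings n))

  Σ2-allStrings : ∀ n (f : Vec Bool (suc n) → Vec Bool (suc n) → ℕ) →
    Σ2 (suc n) f ≡ (Σ2 n (λ u v → f (false ∷ u) (false ∷ v)) + Σ2 n (λ u v → f (false ∷ u) (true ∷ v)))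
                 + (Σ2 n (λ u v → f (true ∷ u) (false ∷ v)) + Σ2 n (λ u v → f (true ∷ u) (true ∷ v)))
  Σ2-allStrings n f = begin
    Σ2 (suc n) f
      ≡⟨ ΣL-allStrings n _ ⟩
    ΣL (λ u → ΣL (f (false ∷ u)) (allStrings (suc n)) + ΣL (f (true ∷ u)) (allStrings (suc n))) (allStrings n)
      ≡⟨ ΣL-cong (allStrings n) (λ u → cong₂ _+_ (ΣL-allStrings n (f (false ∷ u))) (ΣL-allStrings n (f (true ∷ u)))) ⟩
    ΣL (λ u → ΣL (λ v → f (false ∷ u) (false ∷ v) + f (false ∷ u) (true ∷ v)) (allStrings n)
            + ΣL (λ v → f (true ∷ u) (false ∷ v) + f (true ∷ u) (true ∷ v)) (allStrings n)) (allStrings n)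
      ≡⟨ ΣL-+ _ _ (allStrings n) ⟩
    _ ≡⟨ cong₂ _+_ (Σ2-+ n _ _) (Σ2-+ n _ _) ⟩
    _ ∎
    where open ≡-Reasoning

  vertexCount : ∀ n (P : Vec Bool n → Bool) → length (vertices n P) ≡ ΣL (λ u → 𝟙 (P u)) (allStrings n)
  vertexCount n P = length-bfilter P (allStrings n)

  degSum-pairs : ∀ n (P : Vec Bool n → Bool) →
                 degSum n P ≡ Σ2 n (λ u v → 𝟙 (P u) * 𝟙 (P v) * 𝟙 (hamming u v ≡ᵇ 1))
  degSum-pairs n P = begin
    ΣL (degree n P) (bfilter P L)
      ≡⟨ ΣL-bfilter P (degree n P) L ⟩
    ΣL (λ u → 𝟙 (P u) * degree n P u) L
      ≡⟨ ΣL-cong L (λ u → cong (𝟙 (P u) *_) (degree-sum u)) ⟩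
    ΣL (λ u → 𝟙 (P u) * ΣL (λ v → 𝟙 (P v) * 𝟙 (hamming u v ≡ᵇ 1)) L) L
      ≡⟨ ΣL-cong L (λ u → sym (ΣL-*ˡ (𝟙 (P u)) _ L)) ⟩
    ΣL (λ u → ΣL (λ v → 𝟙 (P u) * (𝟙 (P v) * 𝟙 (hamming u v ≡ᵇ 1))) L) L
      ≡⟨ Σ2-cong n (λ u v → sym (*-assoc (𝟙 (P u)) (𝟙 (P v)) _)) ⟩
    Σ2 n (λ u v → 𝟙 (P u) * 𝟙 (P v) * 𝟙 (hamming u v ≡ᵇ 1)) ∎
    where
    open ≡-Reasoning
    L = allStrings n
    degree-sum : ∀ u → degree n P u ≡ ΣL (λ v → 𝟙 (P v) * 𝟙 (hamming u v ≡ᵇ 1)) L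
    degree-sum u = trans (length-bfilter (λ v → hamming u v ≡ᵇ 1) (bfilter P L))
                         (ΣL-bfilter P (λ v → 𝟙 (hamming u v ≡ᵇ 1)) L)

module Counting where

  open import Data.Bool using (Bool; true; false; not; _∧_; _∨_; _xor_; if_then_else_)
  open import Data.Bool.Properties using (∧-identityʳ)
  open import Data.Nat using (ℕ; zero; suc; _+_; _*_; _≡ᵇ_)
  open import Data.Nat.Properties using (+-identityʳ; *-comm)
  open import Data.Nat.Tactic.RingSolver using (solve-∀)
  open import Data.Vec using (Vec; []; _∷_; last)
  open import Relation.Binary.PropositionalEquality
  open Sums

  -- admissible c p u : the string u may follow the letter c inside a Fibonacci string
  -- (c ∷ u is Fibonacci) whose last letter must be 0 when p is 1.  Fibonacci strings are
  -- the admissible strings for c = p = 0, and the Lucas string b ∷ u is admissible for c = p = b.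
  admissible : Bool → Bool → ∀ {n} → Vec Bool n → Bool
  admissible c p u = isFib (c ∷ u) ∧ not (p ∧ last (c ∷ u))

  -- link c a = 1 iff the letter a may follow the letter c (the transfer matrix [[1,1],[1,0]]).
  link : Bool → Bool → ℕ
  link c a = 𝟙 (not (c ∧ a))

  admissible-∷ : ∀ {n} c p a (u : Vec Bool n) → 𝟙 (admissible c p (a ∷ u)) ≡ link c a * 𝟙 (admissible a p u)
  admissible-∷ c p a u with c ∧ a
  ... | true  = refl
  ... | false = sym (+-identityʳ _)

  isFib-admissible : ∀ {n} (u : Vec Bool n) → isFib u ≡ admissible false false u
  isFib-admissible []      = refl
  isFib-admissible (a ∷ u) = sym (∧-identityʳ (isFib (a ∷ u)))

  strings : ℕ → Bool → Bool → ℕ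
  strings zero    c p = 𝟙 (not (p ∧ c))
  strings (suc n) c p = link c false * strings n false p + link c true * strings n true p

  strings-count : ∀ n c p → ΣL (λ u → 𝟙 (admissible c p u)) (allStrings n) ≡ strings n c p
  strings-count zero    c p = +-identityʳ _
  strings-count (suc n) c p = begin
    ΣL (λ u → 𝟙 (admissible c p u)) (allStrings (suc n))
      ≡⟨ ΣL-allStrings n _ ⟩
    ΣL (λ v → 𝟙 (admissible c p (false ∷ v)) + 𝟙 (admissible c p (true ∷ v))) (allStrings n)
      ≡⟨ ΣL-cong (allStrings n) (λ v → cong₂ _+_ (admissible-∷ c p false v) (admissible-∷ c p true v)) ⟩
    ΣL (λ v → link c false * 𝟙 (admissible false p v) + link c true * 𝟙 (admissible true p v)) (allStrings n)
      ≡⟨ ΣL-+ _ _ (allStrings n) ⟩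
    _ ≡⟨ cong₂ _+_ (trans (ΣL-*ˡ (link c false) _ (allStrings n)) (cong (link c false *_) (strings-count n false p)))
                   (trans (ΣL-*ˡ (link c true) _ (allStrings n)) (cong (link c true *_) (strings-count n true p))) ⟩
    strings (suc n) c p ∎
    where open ≡-Reasoning

  -- shift f h = f (h - 1), and 0 at h = 0: differing first letters add 1 to the distance.
  shift : (ℕ → ℕ) → ℕ → ℕ
  shift f zero    = 0
  shift f (suc h) = f h

  shiftBy : Bool → (ℕ → ℕ) → ℕ → ℕ
  shiftBy false f = f
  shiftBy true  f = shift f

  shiftBy-cong : ∀ x {f g : ℕ → ℕ} → (∀ h → f h ≡ g h) → ∀ h → shiftBy x f h ≡ shiftBy x g h
  shiftBy-cong false f≗g h       = f≗g h
  shiftBy-cong true  f≗g zero    = refl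
  shiftBy-cong true  f≗g (suc h) = f≗g h

  -- pairs n c d p q h : the number of ordered pairs (u, v) of strings of length n at Hamming
  -- distance h with u admissible for (c, p) and v admissible for (d, q).
  pairs : ℕ → Bool → Bool → Bool → Bool → ℕ → ℕ
  pairs zero    c d p q h = 𝟙 (not (p ∧ c)) * 𝟙 (not (q ∧ d)) * 𝟙 (0 ≡ᵇ h)
  pairs (suc n) c d p q h =
      (link c false * link d false * pairs n false false p q h + link c false * link d true * shift (pairs n false true p q) h)
    + (link c true * link d false * shift (pairs n true false p q) h + link c true * link d true * pairs n true true p q h)

  pairTerm : Bool → Bool → Bool → Bool → ℕ → ∀ {n} → Vec Bool n → Vec Bool n → ℕ
  pairTerm c d p q h u v = 𝟙 (admissible c p u) * 𝟙 (admissible d q v) * 𝟙 (hamming u v ≡ᵇ h)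

  offsetTerm : Bool → Bool → Bool → Bool → Bool → ℕ → ∀ {n} → Vec Bool n → Vec Bool n → ℕ
  offsetTerm a b p q x h u v = 𝟙 (admissible a p u) * 𝟙 (admissible b q v) * 𝟙 (((if x then 1 else 0) + hamming u v) ≡ᵇ h)

  pairTerm-∷ : ∀ {n} c d p q h a b (u v : Vec Bool n) →
               pairTerm c d p q h (a ∷ u) (b ∷ v) ≡ link c a * link d b * offsetTerm a b p q (a xor b) h u v
  pairTerm-∷ c d p q h a b u v rewrite admissible-∷ c p a u | admissible-∷ d q b v = rearrange (link c a) _ (link d b) _ _
    where
    rearrange : ∀ k x l y z → k * x * (l * y) * z ≡ k * l * (x * y * z)
    rearrange = solve-∀

  offsetTerm-sum : ∀ n a b p q x h → Σ2 n (offsetTerm a b p q x h) ≡ shiftBy x (λ h' → Σ2 n (pairTerm a b p q h')) h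
  offsetTerm-sum n a b p q false h       = refl
  offsetTerm-sum n a b p q true  (suc h) = refl
  offsetTerm-sum n a b p q true  zero    = trans (Σ2-cong n (λ u v → *-comm (admissiblePair u v) 0)) (Σ2-*ˡ n 0 admissiblePair)
    where
    admissiblePair : Vec Bool n → Vec Bool n → ℕ
    admissiblePair u v = 𝟙 (admissible a p u) * 𝟙 (admissible b q v)

  pairs-count : ∀ n c d p q h → Σ2 n (pairTerm c d p q h) ≡ pairs n c d p q h
  pairs-count zero    c d p q h = trans (+-identityʳ _) (+-identityʳ _)
  pairs-count (suc n) c d p q h = begin
    Σ2 (suc n) (pairTerm c d p q h)
      ≡⟨ Σ2-allStrings n _ ⟩
    _ ≡⟨ cong₂ _+_ (cong₂ _+_ (firstLetters false false) (firstLetters false true))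
                   (cong₂ _+_ (firstLetters true false) (firstLetters true true)) ⟩
    pairs (suc n) c d p q h ∎
    where
    open ≡-Reasoning
    firstLetters : ∀ a b → Σ2 n (λ u v → pairTerm c d p q h (a ∷ u) (b ∷ v))
                           ≡ link c a * link d b * shiftBy (a xor b) (pairs n a b p q) h
    firstLetters a b = begin
      Σ2 n (λ u v → pairTerm c d p q h (a ∷ u) (b ∷ v))
        ≡⟨ Σ2-cong n (pairTerm-∷ c d p q h a b) ⟩
      Σ2 n (λ u v → link c a * link d b * offsetTerm a b p q (a xor b) h u v)
        ≡⟨ Σ2-*ˡ n (link c a * link d b) _ ⟩
      link c a * link d b * Σ2 n (offsetTerm a b p q (a xor b) h)
        ≡⟨ cong (link c a * link d b *_) (trans (offsetTerm-sum n a b p q (a xor b) h)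
                                                (shiftBy-cong (a xor b) (pairs-count n a b p q) h)) ⟩
      link c a * link d b * shiftBy (a xor b) (pairs n a b p q) h ∎

  -- At distance 0 the two strings coincide, and a nonempty string admissible for (c, p)
  -- and for (d, q) is exactly one admissible for (c ∨ d, p ∨ q).
  pairs-diagonal : ∀ n c d p q → pairs (suc n) c d p q 0 ≡ strings (suc n) (c ∨ d) (p ∨ q)
  pairs-diagonal zero    c d p q = oneLetter c d p q
    where
    oneLetter : ∀ c d p q → pairs 1 c d p q 0 ≡ strings 1 (c ∨ d) (p ∨ q)
    oneLetter false false false false = refl
    oneLetter false false false true  = refl
    oneLetter false false true  false = refl
    oneLetter false false true  true  = refl
    oneLetter false true  false false = refl
    oneLetter false true  false true  = refl
    oneLetter false true  true  false = refl
    oneLetter false true  true  true  = refl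
    oneLetter true  false false false = refl
    oneLetter true  false false true  = refl
    oneLetter true  false true  false = refl
    oneLetter true  false true  true  = refl
    oneLetter true  true  false false = refl
    oneLetter true  true  false true  = refl
    oneLetter true  true  true  false = refl
    oneLetter true  true  true  true  = refl
  pairs-diagonal (suc n) c d p q
    rewrite pairs-diagonal n false false p q | pairs-diagonal n true true p q = step c d _ _
    where
    step : ∀ c d x y → (link c false * link d false * x + link c false * link d true * 0)
                       + (link c true * link d false * 0 + link c true * link d true * y)
                       ≡ link (c ∨ d) false * x + link (c ∨ d) true * y
    step false false = solve-∀
    step false true  = solve-∀
    step true  false = solve-∀
    step true  true  = solve-∀

module Fibonacci where

  open import Data.Nat using (ℕ; zero; suc; _+_; _*_; _≤_; z≤n; s≤s)
  open import Data.Nat.Properties using (≤-trans; m≤m+n; +-mono-≤; +-comm; +-assoc)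
  open import Data.Nat.Tactic.RingSolver using (solve-∀)
  open import Data.Sum using (_⊎_; inj₁; inj₂)
  open import Relation.Binary.PropositionalEquality

  F : ℕ → ℕ
  F zero          = 0
  F (suc zero)    = 1
  F (suc (suc n)) = F (suc n) + F n

  F-pos : ∀ m → 1 ≤ F (suc m)
  F-pos zero    = s≤s z≤n
  F-pos (suc m) = ≤-trans (F-pos m) (m≤m+n (F (suc m)) (F m))

  F-grows : ∀ m → suc m ≤ F (suc (suc m))
  F-grows zero    = s≤s z≤n
  F-grows (suc m) = subst (_≤ F (suc (suc m)) + F (suc m)) (+-comm (suc m) 1) (+-mono-≤ (F-grows m) (F-pos m))

  Adjacent : ℕ → ℕ → Set
  Adjacent u w = (w ≡ u + 1) ⊎ (w + 1 ≡ u)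

  -- Cassini's identity  F_{j+1}² − F_{j+1} F_j − F_j² = (−1)^j,  in natural numbers.
  cassini : ∀ j → Adjacent (F (suc j) * F j + F j * F j) (F (suc j) * F (suc j))
  cassini zero = inj₁ refl
  cassini (suc j) with cassini j
  ... | inj₁ even = inj₂ (trans (expand₁ a b) (cong ((a + b) * a +_) (sym even)))
    where
    a = F (suc j) ; b = F j
    expand₁ : ∀ a b → (a + b) * (a + b) + 1 ≡ (a + b) * a + (a * b + b * b + 1)
    expand₁ = solve-∀
  ... | inj₂ odd = inj₁ (trans (expand₂ a b) (trans (cong ((a + b) * a +_) (sym odd)) (sym (+-assoc ((a + b) * a) (a * a) 1))))
    where
    a = F (suc j) ; b = F j
    expand₂ : ∀ a b → (a + b) * (a + b) ≡ (a + b) * a + (a * b + b * b)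
    expand₂ = solve-∀

module ClosedForms where

  open import Data.Bool using (Bool; true; false; _∨_)
  open import Data.Bool.Properties using (∨-idem)
  open import Data.Nat using (ℕ; zero; suc; _+_; _*_; _≡ᵇ_)
  open import Data.Nat.Properties using (+-identityʳ; +-cancelʳ-≡; *-cancelˡ-≡)
  open import Data.Nat.Tactic.RingSolver using (solve-∀)
  open import Data.List using (length)
  open import Data.Product using (_×_; _,_; proj₁; proj₂)
  open import Relation.Binary.PropositionalEquality
  open Sums
  open Counting
  open Fibonacci

  strings-false : ∀ n p → strings (suc n) false p ≡ strings n false p + strings n true p
  strings-false n p = cong₂ _+_ (+-identityʳ (strings n false p)) (+-identityʳ (strings n true p))

  strings-true : ∀ n p → strings (suc n) true p ≡ strings n false p
  strings-true n p = trans (+-identityʳ (strings n false p + 0)) (+-identityʳ (strings n false p))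

  strings-fib : ∀ n → (strings n false false ≡ F (2 + n)) × (strings n true false ≡ F (1 + n))
                    × (strings n false true ≡ F (1 + n)) × (strings n true true ≡ F n)
  strings-fib zero = refl , refl , refl , refl
  strings-fib (suc n) with strings-fib n
  ... | ff , tf , ft , tt = trans (strings-false n false) (cong₂ _+_ ff tf) , trans (strings-true n false) ff
                          , trans (strings-false n true) (cong₂ _+_ ft tt) , trans (strings-true n true) ft

  adjacentPairs : ℕ → Bool → ℕ
  adjacentPairs n p = pairs n false false p p 1

  -- Split by the first letters: pairs beginning 00 give adjacentPairs (n+1), pairs beginning 11
  -- continue with 00 and give adjacentPairs n, and pairs beginning 01 or 10 have equal tails.
  adjacentPairs-rec : ∀ n p → adjacentPairs (2 + n) p
                              ≡ adjacentPairs (1 + n) p + adjacentPairs n p + 2 * strings (1 + n) true p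
  adjacentPairs-rec n p = trans (unfold (adjacentPairs (1 + n) p) (pairs (1 + n) false true p p 0)
                                        (pairs (1 + n) true false p p 0) (adjacentPairs n p))
                                (cong (adjacentPairs (1 + n) p + adjacentPairs n p +_)
                                      (cong₂ _+_ (diagonal false true) (trans (diagonal true false) (sym (+-identityʳ _)))))
    where
    unfold : ∀ a b b' c → (1 * 1 * a + 1 * 1 * b) + (1 * 1 * b' + 1 * 1 * ((1 * 1 * c + 0) + (0 + 0)))
                                ≡ a + c + (b + b')
    unfold = solve-∀
    diagonal : ∀ c d → pairs (1 + n) c d p p 0 ≡ strings (1 + n) (c ∨ d) p
    diagonal c d = trans (pairs-diagonal n c d p p) (cong (strings (1 + n) (c ∨ d)) (∨-idem p))

  adjacentPairs-fib : ∀ n → 5 * adjacentPairs n false ≡ 2 * n * F (suc n) + 4 * suc n * F n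
  adjacentPairs-fib zero          = refl
  adjacentPairs-fib (suc zero)    = refl
  adjacentPairs-fib (suc (suc n)) = begin
    5 * adjacentPairs (2 + n) false
      ≡⟨ cong (5 *_) (adjacentPairs-rec n false) ⟩
    5 * (adjacentPairs (1 + n) false + adjacentPairs n false + 2 * strings (1 + n) true false)
      ≡⟨ cong (λ s → 5 * (adjacentPairs (1 + n) false + adjacentPairs n false + 2 * s)) (proj₁ (proj₂ (strings-fib (1 + n)))) ⟩
    5 * (adjacentPairs (1 + n) false + adjacentPairs n false + 2 * F (2 + n))
      ≡⟨ distrib (adjacentPairs (1 + n) false) (adjacentPairs n false) (F (2 + n)) ⟩
    5 * adjacentPairs (1 + n) false + 5 * adjacentPairs n false + 10 * F (2 + n)
      ≡⟨ cong (_+ 10 * F (2 + n)) (cong₂ _+_ (adjacentPairs-fib (suc n)) (adjacentPairs-fib n)) ⟩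
    _ ≡⟨ fibonacciStep n (F n) (F (suc n)) ⟩
    _ ∎
    where
    open ≡-Reasoning
    distrib : ∀ a b c → 5 * (a + b + 2 * c) ≡ 5 * a + 5 * b + 10 * c
    distrib = solve-∀
    fibonacciStep : ∀ n A B → (2 * suc n * (B + A) + 4 * (2 + n) * B) + (2 * n * B + 4 * suc n * A) + 10 * (B + A)
                              ≡ 2 * (2 + n) * ((B + A) + B) + 4 * (3 + n) * (B + A)
    fibonacciStep = solve-∀

  -- The same count for Fibonacci strings ending in 0:  5·adjacentPairs n 1 + 2(n+1) F_n = 4n F_{n+1}.
  adjacentPairs-fib₀ : ∀ n → 5 * adjacentPairs n true + 2 * suc n * F n ≡ 4 * n * F (suc n)
  adjacentPairs-fib₀ zero          = refl
  adjacentPairs-fib₀ (suc zero)    = refl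
  adjacentPairs-fib₀ (suc (suc n)) = +-cancelʳ-≡ _ _ _ (begin
    5 * adjacentPairs (2 + n) true + 2 * (3 + n) * F (2 + n) + T
      ≡⟨ cong (λ e → 5 * e + 2 * (3 + n) * F (2 + n) + T) (adjacentPairs-rec n true) ⟩
    5 * (adjacentPairs (1 + n) true + adjacentPairs n true + 2 * strings (1 + n) true true) + 2 * (3 + n) * F (2 + n) + T
      ≡⟨ cong (λ s → 5 * (adjacentPairs (1 + n) true + adjacentPairs n true + 2 * s) + 2 * (3 + n) * F (2 + n) + T)
              (proj₂ (proj₂ (proj₂ (strings-fib (1 + n))))) ⟩
    5 * (adjacentPairs (1 + n) true + adjacentPairs n true + 2 * F (1 + n)) + 2 * (3 + n) * F (2 + n) + T
      ≡⟨ regroup (adjacentPairs (1 + n) true) (adjacentPairs n true) (F (1 + n)) (2 * (3 + n) * F (2 + n))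
                 (2 * (2 + n) * F (suc n)) (2 * suc n * F n) ⟩
    (5 * adjacentPairs (1 + n) true + 2 * (2 + n) * F (suc n)) + (5 * adjacentPairs n true + 2 * suc n * F n)
      + 10 * F (1 + n) + 2 * (3 + n) * F (2 + n)
      ≡⟨ cong (λ s → s + 10 * F (1 + n) + 2 * (3 + n) * F (2 + n))
              (cong₂ _+_ (adjacentPairs-fib₀ (suc n)) (adjacentPairs-fib₀ n)) ⟩
    _ ≡⟨ fibonacciStep n (F n) (F (suc n)) ⟩
    4 * (2 + n) * F (3 + n) + T ∎)
    where
    open ≡-Reasoning
    T = 2 * (2 + n) * F (suc n) + 2 * suc n * F n
    regroup : ∀ a b f c e g → 5 * (a + b + 2 * f) + c + (e + g) ≡ (5 * a + e) + (5 * b + g) + 10 * f + c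
    regroup = solve-∀
    fibonacciStep : ∀ n A B → 4 * suc n * (B + A) + 4 * n * B + 10 * B + 2 * (3 + n) * (B + A)
                              ≡ 4 * (2 + n) * ((B + A) + B) + (2 * (2 + n) * B + 2 * suc n * A)
    fibonacciStep = solve-∀

  Γ-vertices : ∀ n → length (vertices n isFib) ≡ F (2 + n)
  Γ-vertices n = begin
    length (vertices n isFib)                              ≡⟨ vertexCount n isFib ⟩
    ΣL (λ u → 𝟙 (isFib u)) (allStrings n)                 ≡⟨ ΣL-cong (allStrings n) (λ u → cong 𝟙 (isFib-admissible u)) ⟩
    ΣL (λ u → 𝟙 (admissible false false u)) (allStrings n) ≡⟨ strings-count n false false ⟩
    strings n false false                                  ≡⟨ proj₁ (strings-fib n) ⟩
    F (2 + n)                                              ∎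
    where open ≡-Reasoning

  Γ-degSum : ∀ n → 5 * degSum n isFib ≡ 2 * n * F (suc n) + 4 * suc n * F n
  Γ-degSum n = trans (cong (5 *_) asPairs) (adjacentPairs-fib n)
    where
    asPairs : degSum n isFib ≡ adjacentPairs n false
    asPairs = begin
      degSum n isFib
        ≡⟨ degSum-pairs n isFib ⟩
      Σ2 n (λ u v → 𝟙 (isFib u) * 𝟙 (isFib v) * 𝟙 (hamming u v ≡ᵇ 1))
        ≡⟨ Σ2-cong n (λ u v → cong₂ (λ x y → 𝟙 x * 𝟙 y * 𝟙 (hamming u v ≡ᵇ 1))
                                     (isFib-admissible u) (isFib-admissible v)) ⟩
      Σ2 n (pairTerm false false false false 1)
        ≡⟨ pairs-count n false false false false 1 ⟩
      adjacentPairs n false ∎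
      where open ≡-Reasoning

  -- |V(Λ_{m+1})| = F_{m+2} + F_m: a Lucas string b ∷ u has u admissible for (b, b).
  Λ-vertices : ∀ m → length (vertices (suc m) isLucas) ≡ F (2 + m) + F m
  Λ-vertices m = begin
    length (vertices (suc m) isLucas)
      ≡⟨ vertexCount (suc m) isLucas ⟩
    ΣL (λ u → 𝟙 (isLucas u)) (allStrings (suc m))
      ≡⟨ ΣL-allStrings m _ ⟩
    ΣL (λ u → 𝟙 (admissible false false u) + 𝟙 (admissible true true u)) (allStrings m)
      ≡⟨ ΣL-+ _ _ (allStrings m) ⟩
    _ ≡⟨ cong₂ _+_ (strings-count m false false) (strings-count m true true) ⟩
    strings m false false + strings m true true
      ≡⟨ cong₂ _+_ (proj₁ (strings-fib m)) (proj₂ (proj₂ (proj₂ (strings-fib m)))) ⟩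
    F (2 + m) + F m ∎
    where open ≡-Reasoning

  Λ-degSum-split : ∀ k → degSum (2 + k) isLucas ≡ adjacentPairs (1 + k) false + 2 * F (1 + k) + adjacentPairs k true
  Λ-degSum-split k = begin
    degSum (2 + k) isLucas
      ≡⟨ degSum-pairs (2 + k) isLucas ⟩
    _ ≡⟨ Σ2-allStrings (1 + k) _ ⟩
    _ ≡⟨ cong₂ _+_ (cong₂ _+_ (pairs-count (1 + k) false false false false 1) (pairs-count (1 + k) false true false true 0))
                   (cong₂ _+_ (pairs-count (1 + k) true false true false 0) (pairs-count (1 + k) true true true true 1)) ⟩
    (adjacentPairs (1 + k) false + pairs (1 + k) false true false true 0)
      + (pairs (1 + k) true false true false 0 + pairs (1 + k) true true true true 1)
      ≡⟨ cong₂ (λ x y → (adjacentPairs (1 + k) false + x) + (y + pairs (1 + k) true true true true 1))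
               diagonal₀₁ diagonal₁₀ ⟩
    (adjacentPairs (1 + k) false + F (1 + k)) + (F (1 + k) + pairs (1 + k) true true true true 1)
      ≡⟨ unfold (adjacentPairs (1 + k) false) (F (1 + k)) (adjacentPairs k true) ⟩
    adjacentPairs (1 + k) false + 2 * F (1 + k) + adjacentPairs k true ∎
    where
    open ≡-Reasoning
    -- pairs beginning 01 or 10 have equal tails admissible for (1, 1); pairs beginning 11
    -- continue with 00 and are counted by adjacentPairs k 1 (the last step, unfold)
    diagonal₀₁ : pairs (1 + k) false true false true 0 ≡ F (1 + k)
    diagonal₀₁ = trans (pairs-diagonal k false true false true) (proj₂ (proj₂ (proj₂ (strings-fib (1 + k)))))
    diagonal₁₀ : pairs (1 + k) true false true false 0 ≡ F (1 + k)
    diagonal₁₀ = trans (pairs-diagonal k true false true false) (proj₂ (proj₂ (proj₂ (strings-fib (1 + k)))))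
    unfold : ∀ x f u → (x + f) + (f + ((1 * 1 * u + 0) + (0 + 0))) ≡ x + 2 * f + u
    unfold = solve-∀

  Λ-degSum : ∀ k → degSum (2 + k) isLucas ≡ 2 * (2 + k) * F (1 + k)
  Λ-degSum k = *-cancelˡ-≡ _ _ 5 (+-cancelʳ-≡ _ _ _ (begin
    5 * degSum (2 + k) isLucas + T
      ≡⟨ cong (λ d → 5 * d + T) (Λ-degSum-split k) ⟩
    5 * (adjacentPairs (1 + k) false + 2 * F (1 + k) + adjacentPairs k true) + T
      ≡⟨ regroup (adjacentPairs (1 + k) false) (F (1 + k)) (adjacentPairs k true) T ⟩
    5 * adjacentPairs (1 + k) false + 10 * F (1 + k) + (5 * adjacentPairs k true + T)
      ≡⟨ cong₂ (λ x y → x + 10 * F (1 + k) + y) (adjacentPairs-fib (1 + k)) (adjacentPairs-fib₀ k) ⟩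
    _ ≡⟨ fibonacciStep k (F k) (F (1 + k)) ⟩
    5 * (2 * (2 + k) * F (1 + k)) + T ∎))
    where
    open ≡-Reasoning
    T = 2 * suc k * F k
    regroup : ∀ x f u t → 5 * (x + 2 * f + u) + t ≡ 5 * x + 10 * f + (5 * u + t)
    regroup = solve-∀
    fibonacciStep : ∀ k A B → (2 * suc k * (B + A) + 4 * (2 + k) * B) + 10 * B + 4 * k * B
                              ≡ 5 * (2 * (2 + k) * B) + 2 * suc k * A
    fibonacciStep = solve-∀

module Estimates where

  open import Data.Nat using (ℕ; suc; _+_; _*_; _≤_; _<_; NonZero)
  open import Data.Nat.Properties
  open import Data.Nat.Tactic.RingSolver using (solve-∀)
  open import Data.Sum using (_⊎_; inj₁; inj₂)
  open import Relation.Binary.PropositionalEquality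
  open Fibonacci using (Adjacent)

  -- 5P² and M² agree up to the relative error K/n:  |5P²/M² − 1| ≤ K/n.
  record CloseSquares (n K P M : ℕ) : Set where
    field
      excess  : n * (5 * (P * P)) ≤ (n + K) * (M * M)
      deficit : n * (M * M) ≤ n * (5 * (P * P)) + K * (M * M)

  balanced⇒close : ∀ {n K P M} α β → 5 * (P * P) + α ≡ M * M + β →
                   n * α ≤ K * (M * M) → n * β ≤ K * (M * M) → CloseSquares n K P M
  balanced⇒close {n} {K} {P} {M} α β balance nα≤ nβ≤ = record { excess = excess ; deficit = deficit }
    where
    open ≤-Reasoning
    excess = begin
      n * (5 * (P * P))           ≤⟨ *-monoʳ-≤ n (m≤m+n _ α) ⟩
      n * (5 * (P * P) + α)       ≡⟨ cong (n *_) balance ⟩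
      n * (M * M + β)             ≡⟨ *-distribˡ-+ n (M * M) β ⟩
      n * (M * M) + n * β         ≤⟨ +-monoʳ-≤ (n * (M * M)) nβ≤ ⟩
      n * (M * M) + K * (M * M)   ≡⟨ sym (*-distribʳ-+ (M * M) n K) ⟩
      (n + K) * (M * M)           ∎
    deficit = begin
      n * (M * M)                       ≤⟨ *-monoʳ-≤ n (m≤m+n _ β) ⟩
      n * (M * M + β)                   ≡⟨ cong (n *_) (sym balance) ⟩
      n * (5 * (P * P) + α)             ≡⟨ *-distribˡ-+ n (5 * (P * P)) α ⟩
      n * (5 * (P * P)) + n * α         ≤⟨ +-monoʳ-≤ (n * (5 * (P * P))) nα≤ ⟩
      n * (5 * (P * P)) + K * (M * M)   ∎

  adjacent-balance : ∀ X Y c u w → X + c * u ≡ Y + c * w → Adjacent u w → (X ≡ Y + c) ⊎ (X + c ≡ Y)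
  adjacent-balance X Y c u w eq (inj₁ w≡u+1) = inj₁ (+-cancelʳ-≡ (c * u) X (Y + c) (begin
    X + c * u             ≡⟨ eq ⟩
    Y + c * w             ≡⟨ cong (λ v → Y + c * v) w≡u+1 ⟩
    Y + c * (u + 1)       ≡⟨ regroup Y c u ⟩
    Y + c + c * u         ∎))
    where
    open ≡-Reasoning
    regroup : ∀ Y c u → Y + c * (u + 1) ≡ Y + c + c * u
    regroup = solve-∀
  adjacent-balance X Y c u w eq (inj₂ w+1≡u) = inj₂ (+-cancelʳ-≡ (c * w) (X + c) Y (begin
    X + c + c * w         ≡⟨ regroup X c w ⟩
    X + c * (w + 1)       ≡⟨ cong (λ v → X + c * v) w+1≡u ⟩
    X + c * u             ≡⟨ eq ⟩
    Y + c * w             ∎))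
    where
    open ≡-Reasoning
    regroup : ∀ X c w → X + c + c * w ≡ X + c * (w + 1)
    regroup = solve-∀

  drop-summand : ∀ n {B} x c → n * (x + c) ≤ B → n * x ≤ B
  drop-summand n x c = ≤-trans (*-monoʳ-≤ n (m≤m+n x c))

  -- The shape in which Cassini's identity controls 5P² − M²: an exact balance up to c·(w − u)
  -- with |w − u| = 1, and error terms α + c, β + c of size at most K·M²/n.
  cassini⇒close : ∀ {n K P M} α β c u w → 5 * (P * P) + α + c * u ≡ M * M + β + c * w → Adjacent u w →
                  n * (α + c) ≤ K * (M * M) → n * (β + c) ≤ K * (M * M) → CloseSquares n K P M
  cassini⇒close {n} {K} {P} {M} α β c u w eq uw nα≤ nβ≤
    with adjacent-balance (5 * (P * P) + α) (M * M + β) c u w eq uw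
  ... | inj₁ more = balanced⇒close α (β + c) (trans more (+-assoc (M * M) β c)) (drop-summand n α c nα≤) nβ≤
  ... | inj₂ less = balanced⇒close (α + c) β (trans (sym (+-assoc (5 * (P * P)) α c)) less) nα≤ (drop-summand n β c nβ≤)

  -- From Q/A ≤ 1 + K/n and K(k+1) < 2n:  Q/A < 1 + 2/(k+1).
  ratio-upper : ∀ n K k Q A .{{_ : NonZero A}} → K * suc k < 2 * n → n * Q ≤ (n + K) * A →
                Q * suc k < (k + 3) * A
  ratio-upper n K k Q A Kk<2n nQ≤ = *-cancelˡ-< n (Q * suc k) ((k + 3) * A) (begin-strict
    n * (Q * suc k)                  ≡⟨ sym (*-assoc n Q (suc k)) ⟩
    n * Q * suc k                    ≤⟨ *-monoˡ-≤ (suc k) nQ≤ ⟩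
    (n + K) * A * suc k              ≡⟨ expand n K A k ⟩
    n * (A * suc k) + K * suc k * A  <⟨ +-monoʳ-< (n * (A * suc k)) (*-monoˡ-< A Kk<2n) ⟩
    n * (A * suc k) + 2 * n * A      ≡⟨ collect n A k ⟩
    n * ((k + 3) * A)                ∎)
    where
    open ≤-Reasoning
    expand : ∀ n K A k → (n + K) * A * suc k ≡ n * (A * suc k) + K * suc k * A
    expand = solve-∀
    collect : ∀ n A k → n * (A * suc k) + 2 * n * A ≡ n * ((k + 3) * A)
    collect = solve-∀

  -- From 1 ≤ Q/A + K/n and K(k+1) < 2n:  1 < Q/A + 2/(k+1).
  ratio-lower : ∀ n K k Q A .{{_ : NonZero A}} → K * suc k < 2 * n → n * A ≤ n * Q + K * A →
                suc k * A < Q * suc k + 2 * A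
  ratio-lower n K k Q A Kk<2n nA≤ = *-cancelˡ-< n (suc k * A) (Q * suc k + 2 * A) (begin-strict
    n * (suc k * A)                  ≡⟨ *-comm-inner n A k ⟩
    n * A * suc k                    ≤⟨ *-monoˡ-≤ (suc k) nA≤ ⟩
    (n * Q + K * A) * suc k          ≡⟨ expand n Q K A k ⟩
    n * (Q * suc k) + K * suc k * A  <⟨ +-monoʳ-< (n * (Q * suc k)) (*-monoˡ-< A Kk<2n) ⟩
    n * (Q * suc k) + 2 * n * A      ≡⟨ collect n Q A k ⟩
    n * (Q * suc k + 2 * A)          ∎)
    where
    open ≤-Reasoning
    *-comm-inner : ∀ n A k → n * (suc k * A) ≡ n * A * suc k
    *-comm-inner = solve-∀
    expand : ∀ n Q K A k → (n * Q + K * A) * suc k ≡ n * (Q * suc k) + K * suc k * A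
    expand = solve-∀
    collect : ∀ n Q A k → n * (Q * suc k) + 2 * n * A ≡ n * (Q * suc k + 2 * A)
    collect = solve-∀

module Limit where

  open import Data.Rational.Unnormalised
    using (ℚᵘ; mkℚᵘ; _<_; _≤_; _-_; _+_; _*_; -_; 0ℚᵘ; 1ℚᵘ; _≃_; *≤*; *<*; *≡*; nonNegative; NonNegative)
  open import Data.Rational.Unnormalised.Properties
  open import Data.Rational.Unnormalised.Solver using (module +-*-Solver)
  open +-*-Solver using (solve; _:+_; _:*_; _:-_; con; _:=_)
  open import Data.Product using (_×_; _,_)
  open import Data.Sum using (inj₁; inj₂)
  open import Relation.Nullary using (yes; no)
  open import Data.Integer using (+_; +≤+; +<+)
  import Data.Integer as ℤ
  open import Data.Integer.Properties using (pos-*; pos-+)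
  import Data.Nat as ℕ
  open ℕ using (ℕ; zero; suc)
  import Data.Nat.Properties as ℕₚ
  open import Relation.Binary.PropositionalEquality using (_≡_; sym; trans; cong; cong₂; subst; subst₂)
  open Estimates using (CloseSquares; ratio-upper; ratio-lower)

  twoFifths : ℚᵘ
  twoFifths = mkℚᵘ (+ 2) 4

  -- P / M  (meaningful for M ≥ 1); the sequences avgDegOverN are of this form.
  frac : ℕ → ℕ → ℚᵘ
  frac P M = mkℚᵘ (+ P) (M ℕ.∸ 1)

  add-sub : ∀ s d → (s + d) - d ≃ s
  add-sub = solve 2 (λ s d → (s :+ d) :- d := s) ≃-refl

  +-cancelʳ-< : ∀ p q r → p + r < q + r → p < q
  +-cancelʳ-< p q r p+r<q+r = <-respʳ-≃ (add-sub q r) (<-respˡ-≃ (add-sub p r) (+-monoˡ-< (- r) p+r<q+r))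

  -- If w = 1 − a ≥ 2/5 and 1/5 < w² + (2/5)ε, then a − ε lies below L = 1 − 1/√5:
  -- (w + ε)² = w² + (2w + ε)ε exceeds w² + (2/5)ε.
  below-L : ∀ a ε → 0ℚᵘ < ε → twoFifths ≤ 1ℚᵘ - a →
            oneFifth < (1ℚᵘ - a) * (1ℚᵘ - a) + twoFifths * ε → BelowL (a - ε)
  below-L a ε 0<ε 2/5≤w lower = positive , square
    where
    w = 1ℚᵘ - a
    0≤w : 0ℚᵘ ≤ w
    0≤w = ≤-trans (*≤* (+≤+ ℕ.z≤n)) 2/5≤w
    instance
      _ : NonNegative w
      _ = nonNegative 0≤w
      _ : NonNegative ε
      _ = nonNegative (<⇒≤ 0<ε)
    shifted : 1ℚᵘ - (a - ε) ≃ w + ε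
    shifted = solve 2 (λ a e → con 1ℚᵘ :- (a :- e) := (con 1ℚᵘ :- a) :+ e) ≃-refl a ε
    expand : (1ℚᵘ - (a - ε)) * (1ℚᵘ - (a - ε)) ≃ w * w + (w + w + ε) * ε
    expand = solve 2 (λ a e → (con 1ℚᵘ :- (a :- e)) :* (con 1ℚᵘ :- (a :- e))
                          := (con 1ℚᵘ :- a) :* (con 1ℚᵘ :- a) :+ ((con 1ℚᵘ :- a) :+ (con 1ℚᵘ :- a) :+ e) :* e) ≃-refl a ε
    positive : 0ℚᵘ < 1ℚᵘ - (a - ε)
    positive = <-respʳ-≃ (≃-sym shifted) (<-respˡ-≃ (+-identityˡ 0ℚᵘ) (+-mono-≤-< 0≤w 0<ε))
    square : oneFifth < (1ℚᵘ - (a - ε)) * (1ℚᵘ - (a - ε))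
    square = begin-strict
      oneFifth                   <⟨ lower ⟩
      w * w + twoFifths * ε      ≤⟨ +-monoʳ-≤ (w * w) (*-monoˡ-≤-nonNeg ε (≤-trans 2/5≤w (≤-trans (p≤p+q w w) (p≤p+q (w + w) ε)))) ⟩
      w * w + (w + w + ε) * ε    ≃⟨ ≃-sym expand ⟩
      (1ℚᵘ - (a - ε)) * (1ℚᵘ - (a - ε)) ∎
      where open ≤-Reasoning

  -- If w = 1 − a ≥ 2/5 and w² < 1/5 + (2/5)ε, then a + ε lies above L:
  -- either z = 1 − (a + ε) ≤ 0, or z² = w² − (2z + ε)ε is below w² − (2/5)ε.
  above-L : ∀ a ε → 0ℚᵘ < ε → twoFifths ≤ 1ℚᵘ - a →
            (1ℚᵘ - a) * (1ℚᵘ - a) < oneFifth + twoFifths * ε → AboveL (a + ε)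
  above-L a ε 0<ε 2/5≤w upper with 1ℚᵘ - (a + ε) ≤? 0ℚᵘ
  ... | yes z≤0 = inj₁ z≤0
  ... | no  z≰0 = inj₂ (+-cancelʳ-< (z * z) oneFifth (twoFifths * ε) (begin-strict
      z * z + twoFifths * ε      ≤⟨ +-monoʳ-≤ (z * z) (*-monoˡ-≤-nonNeg ε 2/5≤2z+ε) ⟩
      z * z + (z + z + ε) * ε    ≃⟨ ≃-sym expand ⟩
      w * w                      <⟨ upper ⟩
      oneFifth + twoFifths * ε   ∎))
    where
    open ≤-Reasoning
    w = 1ℚᵘ - a
    z = 1ℚᵘ - (a + ε)
    instance
      _ : NonNegative z
      _ = nonNegative (<⇒≤ (≰⇒> z≰0))
      _ : NonNegative ε
      _ = nonNegative (<⇒≤ 0<ε)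
    shifted : w ≃ z + ε
    shifted = solve 2 (λ a e → con 1ℚᵘ :- a := (con 1ℚᵘ :- (a :+ e)) :+ e) ≃-refl a ε
    expand : w * w ≃ z * z + (z + z + ε) * ε
    expand = solve 2 (λ a e → (con 1ℚᵘ :- a) :* (con 1ℚᵘ :- a)
                          := (con 1ℚᵘ :- (a :+ e)) :* (con 1ℚᵘ :- (a :+ e)) :+ ((con 1ℚᵘ :- (a :+ e)) :+ (con 1ℚᵘ :- (a :+ e)) :+ e) :* e) ≃-refl a ε
    2/5≤2z+ε : twoFifths ≤ z + z + ε
    2/5≤2z+ε = ≤-trans 2/5≤w (≤-trans (≤-reflexive shifted) (+-monoˡ-≤ ε (p≤p+q z z)))

  twoFifths≤frac : ∀ P M → 1 ℕ.≤ M → 2 ℕ.* M ℕ.≤ P ℕ.* 5 → twoFifths ≤ frac P M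
  twoFifths≤frac P (suc M₀) _ h = *≤* (subst₂ ℤ._≤_ (pos-* 2 (suc M₀)) (pos-* P 5) (+≤+ h))

  frac²-upper : ∀ P M k → 1 ℕ.≤ M → 5 ℕ.* (P ℕ.* P) ℕ.* suc k ℕ.< (k ℕ.+ 3) ℕ.* (M ℕ.* M) →
                frac P M * frac P M < oneFifth + twoFifths * mkℚᵘ (+ 1) k
  frac²-upper P (suc M₀) k _ h = *<* (subst₂ ℤ._<_ lhs rhs (+<+ cleared))
    where
    A = suc M₀ ℕ.* suc M₀
    c = 5 ℕ.* suc k
    cleared : P ℕ.* P ℕ.* (5 ℕ.* c) ℕ.< (1 ℕ.* c ℕ.+ 2 ℕ.* 1 ℕ.* 5) ℕ.* A
    cleared = subst₂ ℕ._<_ (scaleˡ P k) (scaleʳ A k) (ℕₚ.*-monoʳ-< 5 h)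
      where
      open import Data.Nat.Tactic.RingSolver using (solve-∀)
      scaleˡ : ∀ P k → 5 ℕ.* (5 ℕ.* (P ℕ.* P) ℕ.* suc k) ≡ P ℕ.* P ℕ.* (5 ℕ.* (5 ℕ.* suc k))
      scaleˡ = solve-∀
      scaleʳ : ∀ A k → 5 ℕ.* ((k ℕ.+ 3) ℕ.* A) ≡ (1 ℕ.* (5 ℕ.* suc k) ℕ.+ 2 ℕ.* 1 ℕ.* 5) ℕ.* A
      scaleʳ = solve-∀
    lhs = trans (pos-* (P ℕ.* P) (5 ℕ.* c)) (cong (ℤ._* + (5 ℕ.* c)) (pos-* P P))
    rhs = trans (pos-* (1 ℕ.* c ℕ.+ 2 ℕ.* 1 ℕ.* 5) A)
                (cong (ℤ._* + A) (trans (pos-+ (1 ℕ.* c) (2 ℕ.* 1 ℕ.* 5))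
                                        (cong₂ ℤ._+_ (pos-* 1 c) (trans (pos-* (2 ℕ.* 1) 5) (cong (ℤ._* + 5) (pos-* 2 1))))))

  frac²-lower : ∀ P M k → 1 ℕ.≤ M → suc k ℕ.* (M ℕ.* M) ℕ.< 5 ℕ.* (P ℕ.* P) ℕ.* suc k ℕ.+ 2 ℕ.* (M ℕ.* M) →
                oneFifth < frac P M * frac P M + twoFifths * mkℚᵘ (+ 1) k
  frac²-lower P (suc M₀) k _ h = *<* (subst₂ ℤ._<_ lhs rhs (+<+ cleared))
    where
    A = suc M₀ ℕ.* suc M₀
    c = 5 ℕ.* suc k
    cleared : 1 ℕ.* (A ℕ.* c) ℕ.< (P ℕ.* P ℕ.* c ℕ.+ 2 ℕ.* 1 ℕ.* A) ℕ.* 5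
    cleared = subst₂ ℕ._<_ (scaleˡ A k) (scaleʳ P A k) (ℕₚ.*-monoʳ-< 5 h)
      where
      open import Data.Nat.Tactic.RingSolver using (solve-∀)
      scaleˡ : ∀ A k → 5 ℕ.* (suc k ℕ.* A) ≡ 1 ℕ.* (A ℕ.* (5 ℕ.* suc k))
      scaleˡ = solve-∀
      scaleʳ : ∀ P A k → 5 ℕ.* (5 ℕ.* (P ℕ.* P) ℕ.* suc k ℕ.+ 2 ℕ.* A) ≡ (P ℕ.* P ℕ.* (5 ℕ.* suc k) ℕ.+ 2 ℕ.* 1 ℕ.* A) ℕ.* 5
      scaleʳ = solve-∀
    lhs = pos-* 1 (A ℕ.* c)
    rhs = trans (pos-* (P ℕ.* P ℕ.* c ℕ.+ 2 ℕ.* 1 ℕ.* A) 5)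
                (cong (ℤ._* + 5) (trans (pos-+ (P ℕ.* P ℕ.* c) (2 ℕ.* 1 ℕ.* A))
                                        (cong₂ ℤ._+_ (trans (pos-* (P ℕ.* P) c) (cong (ℤ._* + c) (pos-* P P)))
                                                     (trans (pos-* (2 ℕ.* 1) A) (cong (ℤ._* + A) (pos-* 2 1))))))

  one-minus-frac : ∀ D L P M → 1 ℕ.≤ L → 1 ℕ.≤ M → P ℕ.* L ℕ.+ D ℕ.* M ≡ M ℕ.* L → 1ℚᵘ - frac D L ≃ frac P M
  one-minus-frac D (suc L₀) P (suc M₀) _ _ h = ≃-trans (+-congˡ (- frac D (suc L₀)) (≃-sym sum≃1)) (add-sub (frac P (suc M₀)) (frac D (suc L₀)))
    where
    sum≃1 : frac P (suc M₀) + frac D (suc L₀) ≃ 1ℚᵘ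
    sum≃1 = *≡* (trans (sym (trans (pos-* (P ℕ.* suc L₀ ℕ.+ D ℕ.* suc M₀) 1)
                                    (cong (ℤ._* + 1) (trans (pos-+ (P ℕ.* suc L₀) (D ℕ.* suc M₀))
                                                            (cong₂ ℤ._+_ (pos-* P (suc L₀)) (pos-* D (suc M₀)))))))
                       (trans (cong +_ (trans (ℕₚ.*-identityʳ _) (trans h (sym (ℕₚ.*-identityˡ _)))))
                              (pos-* 1 (suc M₀ ℕ.* suc L₀))))

  -- A certificate that a n is close to L: 1 − a n = P/M ≥ 2/5 with 5P² ≈ M² up to relative error K/n.
  record Certificate (a : ℕ → ℚᵘ) (K n : ℕ) : Set where
    field
      P M       : ℕ
      M-pos     : 1 ℕ.≤ M
      ratio     : 1ℚᵘ - a n ≃ frac P M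
      ratio≥2/5 : 2 ℕ.* M ℕ.≤ P ℕ.* 5
      close     : CloseSquares n K P M

  certified-near-L : ∀ {a K n} k ε → Certificate a K n → K ℕ.* suc k ℕ.< n → 0ℚᵘ < ε → mkℚᵘ (+ 1) k ≤ ε →
                     BelowL (a n - ε) × AboveL (a n + ε)
  certified-near-L {a} {K} {n} k ε c Kk<n 0<ε δ≤ε = below-L (a n) ε 0<ε 2/5≤w lower , above-L (a n) ε 0<ε 2/5≤w upper
    where
    open Certificate c
    open CloseSquares close
    open ≤-Reasoning
    instance
      _ : ℕ.NonZero (M ℕ.* M)
      _ = ℕₚ.m*n≢0 M M {{ℕ.>-nonZero M-pos}} {{ℕ.>-nonZero M-pos}}
    w = 1ℚᵘ - a n
    x = frac P M
    Kk<2n : K ℕ.* suc k ℕ.< 2 ℕ.* n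
    Kk<2n = ℕₚ.<-≤-trans Kk<n (ℕₚ.m≤m+n n (n ℕ.+ 0))
    2/5≤w : twoFifths ≤ w
    2/5≤w = ≤-respʳ-≃ (≃-sym ratio) (twoFifths≤frac P M M-pos ratio≥2/5)
    δ-to-ε : twoFifths * mkℚᵘ (+ 1) k ≤ twoFifths * ε
    δ-to-ε = *-monoʳ-≤-nonNeg twoFifths δ≤ε
    upper : w * w < oneFifth + twoFifths * ε
    upper = begin-strict
      w * w                                ≃⟨ *-cong ratio ratio ⟩
      x * x                                <⟨ frac²-upper P M k M-pos (ratio-upper n K k (5 ℕ.* (P ℕ.* P)) (M ℕ.* M) Kk<2n excess) ⟩
      oneFifth + twoFifths * mkℚᵘ (+ 1) k  ≤⟨ +-monoʳ-≤ oneFifth δ-to-ε ⟩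
      oneFifth + twoFifths * ε             ∎
    lower : oneFifth < w * w + twoFifths * ε
    lower = begin-strict
      oneFifth                             <⟨ frac²-lower P M k M-pos (ratio-lower n K k (5 ℕ.* (P ℕ.* P)) (M ℕ.* M) Kk<2n deficit) ⟩
      x * x + twoFifths * mkℚᵘ (+ 1) k     ≤⟨ +-monoʳ-≤ (x * x) δ-to-ε ⟩
      x * x + twoFifths * ε                ≃⟨ +-congˡ (twoFifths * ε) (≃-sym (*-cong ratio ratio)) ⟩
      w * w + twoFifths * ε                ∎

  -- Convergence criterion: certificates with a uniform constant K for all n ≥ n₀ give a n → L.
  -- For ε = (p+1)/(k+1) take N = n₀ + K(k+1) + 1.
  converges : ∀ a n₀ K → (∀ s → Certificate a K (n₀ ℕ.+ s)) → ConvergesToL a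
  converges a n₀ K cert (mkℚᵘ (+ zero)   k) (*<* (+<+ ()))
  converges a n₀ K cert (mkℚᵘ ℤ.-[1+ p ] k) (*<* ())
  converges a n₀ K cert ε@(mkℚᵘ (+ suc p) k) 0<ε = n₀ ℕ.+ suc (K ℕ.* suc k) , near
    where
    δ≤ε : mkℚᵘ (+ 1) k ≤ ε
    δ≤ε = *≤* (subst₂ ℤ._≤_ (pos-* 1 (suc k)) (pos-* (suc p) (suc k)) (+≤+ (ℕₚ.*-monoˡ-≤ (suc k) {1} {suc p} (ℕ.s≤s ℕ.z≤n))))
    near : ∀ n → n ℕ.≥ n₀ ℕ.+ suc (K ℕ.* suc k) → BelowL (a n - ε) × AboveL (a n + ε)
    near n n≥N = subst (λ m → BelowL (a m - ε) × AboveL (a m + ε)) n₀+s≡n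
                       (certified-near-L k ε (cert s) (subst (K ℕ.* suc k ℕ.<_) (sym n₀+s≡n) Kk<n) 0<ε δ≤ε)
      where
      s = n ℕ.∸ n₀
      n₀+s≡n : n₀ ℕ.+ s ≡ n
      n₀+s≡n = ℕₚ.m+[n∸m]≡n (ℕₚ.m+n≤o⇒m≤o n₀ n≥N)
      Kk<n : K ℕ.* suc k ℕ.< n
      Kk<n = ℕₚ.≤-trans (ℕₚ.m≤n+m (suc (K ℕ.* suc k)) n₀) n≥N

module Certificates where

  open import Data.Nat using (ℕ; suc; _+_; _*_; _≤_; z≤n; s≤s)
  open import Data.Nat.Properties
  open import Data.Nat.Tactic.RingSolver using (solve-∀)
  open import Data.Product using (_×_; _,_; proj₁; proj₂)
  open import Data.List using (length)
  open import Relation.Binary.PropositionalEquality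
  open Fibonacci
  open ClosedForms using (Γ-vertices; Γ-degSum; Λ-vertices; Λ-degSum)
  open Estimates using (cassini⇒close)
  open Limit using (Certificate; one-minus-frac)

  ≤-by-slack : ∀ x r y → x + r ≡ y → x ≤ y
  ≤-by-slack x r y eq = ≤-trans (m≤m+n x r) (≤-reflexive eq)

  -- The error terms for Γ_n are O(M²/n) where M = 5 F_{n+2} n, because n ≤ F_{n+2} = a + b.
  Γ-errors : ∀ n a b → 1 ≤ n → n ≤ a + b →
             (n * (40 * n * (b * (3 * a + b)) + 20 * (n * n)) ≤ 8 * (5 * ((a + b) * n) * (5 * ((a + b) * n))))
           × (n * (80 * (b * b) + 20 * (n * n)) ≤ 8 * (5 * ((a + b) * n) * (5 * ((a + b) * n))))
  Γ-errors n a b 1≤n n≤a+b = bound₁ , bound₂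
    where
    Q = (a + b) * n
    nb≤Q : n * b ≤ Q
    nb≤Q = subst (n * b ≤_) (*-comm n (a + b)) (*-monoʳ-≤ n (m≤n+m b a))
    n[3a+b]≤3Q : n * (3 * a + b) ≤ 3 * Q
    n[3a+b]≤3Q = subst (n * (3 * a + b) ≤_) (regroup n a b) (*-monoʳ-≤ n (+-monoʳ-≤ (3 * a) (m≤n+m b (2 * b))))
      where
      regroup : ∀ n a b → n * (3 * a + (2 * b + b)) ≡ 3 * ((a + b) * n)
      regroup = solve-∀
    n²≤Q : n * n ≤ Q
    n²≤Q = *-monoˡ-≤ n n≤a+b
    n≤Q : n ≤ Q
    n≤Q = subst (_≤ Q) (*-identityˡ n) (*-monoˡ-≤ n (≤-trans 1≤n n≤a+b))
    b≤Q : b ≤ Q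
    b≤Q = ≤-trans (m≤n+m b a) (subst (_≤ Q) (*-identityʳ (a + b)) (*-monoʳ-≤ (a + b) 1≤n))
    bound₁ = begin
      n * (40 * n * (b * (3 * a + b)) + 20 * (n * n))   ≡⟨ expand₁ n a b ⟩
      40 * (n * b) * (n * (3 * a + b)) + 20 * n * (n * n)
        ≤⟨ +-mono-≤ (*-mono-≤ (*-monoʳ-≤ 40 nb≤Q) n[3a+b]≤3Q) (*-mono-≤ (*-monoʳ-≤ 20 n≤Q) n²≤Q) ⟩
      40 * Q * (3 * Q) + 20 * Q * Q                      ≤⟨ ≤-by-slack _ _ _ (collect₁ Q) ⟩
      8 * (5 * Q * (5 * Q))                              ∎
      where
      open ≤-Reasoning
      expand₁ : ∀ n a b → n * (40 * n * (b * (3 * a + b)) + 20 * (n * n)) ≡ 40 * (n * b) * (n * (3 * a + b)) + 20 * n * (n * n)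
      expand₁ = solve-∀
      collect₁ : ∀ Q → 40 * Q * (3 * Q) + 20 * Q * Q + 60 * Q * Q ≡ 8 * (5 * Q * (5 * Q))
      collect₁ = solve-∀
    bound₂ = begin
      n * (80 * (b * b) + 20 * (n * n))   ≡⟨ expand₂ n b ⟩
      80 * (n * b) * b + 20 * n * (n * n)
        ≤⟨ +-mono-≤ (*-mono-≤ (*-monoʳ-≤ 80 nb≤Q) b≤Q) (*-mono-≤ (*-monoʳ-≤ 20 n≤Q) n²≤Q) ⟩
      80 * Q * Q + 20 * Q * Q             ≤⟨ ≤-by-slack _ _ _ (collect₂ Q) ⟩
      8 * (5 * Q * (5 * Q))               ∎
      where
      open ≤-Reasoning
      expand₂ : ∀ n b → n * (80 * (b * b) + 20 * (n * n)) ≡ 80 * (n * b) * b + 20 * n * (n * n)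
      expand₂ = solve-∀
      collect₂ : ∀ Q → 80 * Q * Q + 20 * Q * Q + 100 * Q * Q ≡ 8 * (5 * Q * (5 * Q))
      collect₂ = solve-∀

  -- For n = s + 8, with a = F_{n+1}, b = F_n, c = F_{n-1}:
  -- 1 − avgdeg(Γ_n)/n = P/M with P = 4(n−1)b + 3nc and M = 5 F_{n+2} n, and by Cassini
  -- 5P² − M² = ±20n² − 40nb(3a + b) + 80b².
  Γ-certificate : ∀ s → Certificate Γ-ratio 8 (8 + s)
  Γ-certificate s = record
    { P = P ; M = M ; M-pos = 1≤M
    ; ratio = one-minus-frac D (|V| * n) P M 1≤|V|n 1≤M fractions
    ; ratio≥2/5 = ≤-by-slack (2 * M) _ (P * 5) (slack s (F (6 + s)) (F (5 + s)))
    ; close = cassini⇒close (40 * n * (b * (3 * a + b))) (80 * (b * b)) (20 * (n * n)) (a * b + b * b) (a * a)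
                            (squares t b c) (cassini n) bound₁ bound₂
    }
    where
    n = 8 + s
    t = 7 + s
    a = F (9 + s)
    b = F (8 + s)
    c = F (7 + s)
    P = 4 * t * b + 3 * n * c
    Q = F (10 + s) * n
    M = 5 * Q
    D = degSum n isFib
    |V| = length (vertices n isFib)
    1≤Q : 1 ≤ Q
    1≤Q = *-mono-≤ (F-pos (9 + s)) (s≤s z≤n)
    1≤M : 1 ≤ M
    1≤M = ≤-trans 1≤Q (m≤m+n Q (4 * Q))
    |V|n≡Q : |V| * n ≡ Q
    |V|n≡Q = cong (_* n) (Γ-vertices n)
    1≤|V|n : 1 ≤ |V| * n
    1≤|V|n = subst (1 ≤_) (sym |V|n≡Q) 1≤Q
    fractions : P * (|V| * n) + D * M ≡ M * (|V| * n)
    fractions = begin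
      P * (|V| * n) + D * M        ≡⟨ cong (λ q → P * q + D * M) |V|n≡Q ⟩
      P * Q + D * (5 * Q)          ≡⟨ factor P D Q ⟩
      (P + 5 * D) * Q              ≡⟨ cong (λ d → (P + d) * Q) (Γ-degSum n) ⟩
      (P + (2 * n * a + 4 * suc n * b)) * Q ≡⟨ cong (_* Q) (numerator t b c) ⟩
      M * Q                        ≡⟨ cong (M *_) (sym |V|n≡Q) ⟩
      M * (|V| * n)                ∎
      where
      open ≡-Reasoning
      factor : ∀ P D Q → P * Q + D * (5 * Q) ≡ (P + 5 * D) * Q
      factor = solve-∀
      numerator : ∀ t b c → 4 * t * b + 3 * suc t * c + (2 * suc t * (b + c) + 4 * suc (suc t) * b) ≡ 5 * (((b + c) + b) * suc t)
      numerator = solve-∀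
    -- 5P − 2M = 5(sE + (s + 4)G) with E = F_{n-2}, G = F_{n-3}; this is where n ≥ 8 is needed
    slack : ∀ s E G → 2 * (5 * (((((E + G) + E) + (E + G)) + ((E + G) + E)) * (8 + s))) + (5 * s * E + 5 * s * G + 20 * G)
                      ≡ (4 * (7 + s) * ((E + G) + E) + 3 * (8 + s) * (E + G)) * 5
    slack = solve-∀
    squares : ∀ t b c → let n = suc t ; a = b + c ; P = 4 * t * b + 3 * n * c ; M = 5 * ((a + b) * n) in
              5 * (P * P) + 40 * n * (b * (3 * a + b)) + 20 * (n * n) * (a * b + b * b) ≡ M * M + 80 * (b * b) + 20 * (n * n) * (a * a)
    squares = solve-∀
    bounds = Γ-errors n a b (s≤s z≤n) (≤-trans (n≤1+n n) (F-grows n))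
    bound₁ = proj₁ bounds
    bound₂ = proj₂ bounds

  -- The error term for Λ_n is O(M²/n) where M = ℓ n, because n ≤ ℓ.
  Λ-error : ∀ n ℓ → 1 ≤ n → n ≤ ℓ → n * (0 + 4 * (n * n)) ≤ 4 * (ℓ * n * (ℓ * n))
  Λ-error n ℓ 1≤n n≤ℓ = begin
    n * (4 * (n * n))       ≡⟨ regroup n ⟩
    4 * (n * (n * n))       ≤⟨ *-monoʳ-≤ 4 (*-mono-≤ n≤M n²≤M) ⟩
    4 * (ℓ * n * (ℓ * n))   ∎
    where
    open ≤-Reasoning
    regroup : ∀ n → n * (4 * (n * n)) ≡ 4 * (n * (n * n))
    regroup = solve-∀
    n≤M : n ≤ ℓ * n
    n≤M = subst (_≤ ℓ * n) (*-identityˡ n) (*-monoˡ-≤ n (≤-trans 1≤n n≤ℓ))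
    n²≤M : n * n ≤ ℓ * n
    n²≤M = *-monoˡ-≤ n n≤ℓ

  -- For n = s + 8, with b = F_n, c = F_{n-1} and the Lucas number ℓ = F_{n+1} + F_{n-1}:
  -- 1 − avgdeg(Λ_n)/n = P/M with P = n b and M = ℓ n, and by Cassini 5P² − M² = ±4n².
  Λ-certificate : ∀ s → Certificate Λ-ratio 4 (8 + s)
  Λ-certificate s = record
    { P = P ; M = M ; M-pos = 1≤M
    ; ratio = one-minus-frac D (|V| * n) P M 1≤|V|n 1≤M fractions
    ; ratio≥2/5 = ≤-by-slack (2 * M) _ (P * 5) (slack s (F (5 + s)) (F (4 + s)))
    ; close = cassini⇒close 0 0 (4 * (n * n)) (b * c + c * c) (b * b) (squares n b c) (cassini (7 + s)) bound bound
    }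
    where
    n = 8 + s
    b = F (8 + s)
    c = F (7 + s)
    ℓ = F (9 + s) + c
    P = n * b
    M = ℓ * n
    D = degSum n isLucas
    |V| = length (vertices n isLucas)
    n≤ℓ : n ≤ ℓ
    n≤ℓ = ≤-trans (F-grows (7 + s)) (m≤m+n (F (9 + s)) c)
    1≤M : 1 ≤ M
    1≤M = *-mono-≤ (≤-trans (s≤s z≤n) n≤ℓ) (s≤s z≤n)
    |V|n≡M : |V| * n ≡ M
    |V|n≡M = cong (_* n) (Λ-vertices (7 + s))
    1≤|V|n : 1 ≤ |V| * n
    1≤|V|n = subst (1 ≤_) (sym |V|n≡M) 1≤M
    fractions : P * (|V| * n) + D * M ≡ M * (|V| * n)
    fractions = begin
      P * (|V| * n) + D * M    ≡⟨ cong (λ q → P * q + D * M) |V|n≡M ⟩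
      P * M + D * M            ≡⟨ sym (*-distribʳ-+ M P D) ⟩
      (P + D) * M              ≡⟨ cong (λ d → (P + d) * M) (Λ-degSum (6 + s)) ⟩
      (P + 2 * n * c) * M      ≡⟨ cong (_* M) (numerator n b c) ⟩
      M * M                    ≡⟨ cong (M *_) (sym |V|n≡M) ⟩
      M * (|V| * n)            ∎
      where
      open ≡-Reasoning
      numerator : ∀ n b c → n * b + 2 * n * c ≡ ((b + c) + c) * n
      numerator = solve-∀
    -- 5P − 2M = n(G + 2H) with G = F_{n-3}, H = F_{n-4}
    slack : ∀ s G H → 2 * ((((((G + H) + G) + (G + H)) + ((G + H) + G)) + ((G + H) + G)) * (8 + s)) + (8 + s) * (G + 2 * H)
                      ≡ (8 + s) * (((G + H) + G) + (G + H)) * 5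
    slack = solve-∀
    squares : ∀ n b c → 5 * (n * b * (n * b)) + 0 + 4 * (n * n) * (b * c + c * c) ≡ ((b + c) + c) * n * (((b + c) + c) * n) + 0 + 4 * (n * n) * (b * b)
    squares = solve-∀
    bound : n * (0 + 4 * (n * n)) ≤ 4 * (M * M)
    bound = Λ-error n ℓ (s≤s z≤n) n≤ℓ

theorem5p1 : ConvergesToL Γ-ratio × ConvergesToL Λ-ratio
theorem5p1 = converges Γ-ratio 8 8 Γ-certificate , converges Λ-ratio 8 4 Λ-certificate
  where
  open import Data.Product using (_,_)
  open Limit using (converges)
  open Certificates using (Γ-certificate; Λ-certificate)
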